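{- For binary words $w_1,w_2$, we have $[\sigma(w_1)] = [\sigma(w_2)]$ if and only if either $w_1 = w_2$, or there exist $a,b \geq 0$ such that $\{w_1,w_2\} = \{0^{a+1}1^b,\ 1^{b+1}0^a\}$.
   Context: For a binary word $w=w_1\cdots w_{n-1}$, the permutation $\sigma(w)=\sigma_1\cdots\sigma_n$ of $[n]$ is defined by: for $k=1,\dots,n-1$, $\sigma_k$ is the minimum of $[n]\setminus\{\sigma_1,\dots,\sigma_{k-1}\}$ if $w_k=0$ and the maximum of this set if $w_k=1$; $\sigma_n$ is the remaining element. A circular permutation $[\pi]$ is the set of all rotations of the permutation $\pi$. -}

module Defs where

open import Data.Bool using (Bool; true; false)
open import Data.Nat using (ℕ; zero; suc; _<_)
open import Data.List using (List; []; _∷_; _++_; drop; take; length; replicate; filter; upTo; map)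
open import Data.Nat.Properties using (_≟_)
open import Data.Product using (Σ; _×_; ∃-syntax)
open import Relation.Binary.PropositionalEquality using (_≡_)
open import Relation.Nullary using (¬_)
open import Relation.Unary using (∁)

-- Binary words: letters 0 = false, 1 = true.
Word : Set
Word = List Bool

[1‥_] : ℕ → List ℕ
[1‥ n ] = map suc (upTo n)

headOr : List ℕ → ℕ
headOr []      = 0
headOr (x ∷ _) = x

lastOr : List ℕ → ℕ
lastOr []           = 0
lastOr (x ∷ [])     = x
lastOr (_ ∷ y ∷ ys) = lastOr (y ∷ ys)

remove : ℕ → List ℕ → List ℕ
remove x = filter (λ y → ¬? (y ≟ x))
  where
  open import Relation.Nullary.Decidable using (¬?)

-- σ-construction from a list of remaining elements (kept in increasing order):
-- letter 0 takes the minimum, letter 1 the maximum; when the word ends,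
-- the remaining element(s) are appended.
σ-aux : Word → List ℕ → List ℕ
σ-aux []          rest = rest
σ-aux (false ∷ w) rest = headOr rest ∷ σ-aux w (remove (headOr rest) rest)
σ-aux (true ∷ w)  rest = lastOr rest ∷ σ-aux w (remove (lastOr rest) rest)

σ : Word → List ℕ
σ w = σ-aux w [1‥ suc (length w) ]

rotate : ℕ → List ℕ → List ℕ
rotate k π = drop k π ++ take k π

-- [π] = [τ]: τ is a rotation of π (the circular permutations coincide)
SameCircular : List ℕ → List ℕ → Set
SameCircular π τ = ∃[ k ] (k < length π × rotate k π ≡ τ)

{-# OPTIONS --safe #-}
-- The values still available while σ(w) is built always form an interval, so σ(w) has a
-- closed form: a letter 0 emits the bottom of the interval, a letter 1 the top.  Write a
-- rotation as σ(w₁) = P ++ D, σ(w₂) = D ++ P with P, D nonempty.  If w₁ and w₂ both had a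
-- 0 among their first |P|, resp. |D|, letters, the value 1 would lie in P and in D.  So by
-- symmetry w₁ starts with |P| ones: then P is the top block, listed decreasingly, and D is
-- σ of the rest of w₁ on the bottom block.  As a prefix of σ(w₂) avoiding the maximum, D
-- forces w₂ to start with |D| zeros, so D is listed increasingly; injectivity of the closed
-- form then pins down both words.
module Submission where

open import Defs
open import Data.Bool using (Bool; true; false; not)
open import Data.Bool.Properties using (¬-not) renaming (_≟_ to _≟ᵇ_)
open import Data.Empty using (⊥-elim)
open import Data.List using (List; []; _∷_; _++_; _∷ʳ_; replicate; length; take; drop; applyUpTo; applyDownFrom)
open import Data.List.Membership.Propositional using (_∈_)
open import Data.List.Properties
  using (∷-injectiveˡ; ∷-injectiveʳ; length-++; length-replicate; length-applyDownFrom; ++-identityʳ;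
         take++drop≡id; map-applyUpTo; filter-all; filter-reject; filter-++)
open import Data.List.Relation.Unary.All as All using (All; []; _∷_)
open import Data.List.Relation.Unary.All.Properties using (drop⁺)
open import Data.List.Relation.Unary.Any using (here; there)
open import Data.Nat using (ℕ; zero; suc; _+_; _≤_; _<_; s≤s; z<s)
open import Data.Nat.Properties
open import Data.Product as Product using (_×_; _,_; proj₁; proj₂; ∃-syntax)
open import Data.Sum as Sum using (_⊎_; inj₁; inj₂)
open import Function.Bundles using (_⇔_; mk⇔)
open import Relation.Binary.PropositionalEquality
open import Relation.Nullary using (yes; no; ¬_)
open import Relation.Nullary.Decidable using (¬?)

module _ {A : Set} where

  take-length-++ : ∀ (xs ys : List A) → take (length xs) (xs ++ ys) ≡ xs
  take-length-++ []       ys = refl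
  take-length-++ (x ∷ xs) ys = cong (x ∷_) (take-length-++ xs ys)

  drop-length-++ : ∀ (xs ys : List A) → drop (length xs) (xs ++ ys) ≡ ys
  drop-length-++ []       ys = refl
  drop-length-++ (x ∷ xs) ys = drop-length-++ xs ys

  ++-cancel-≡length : ∀ {xs ys xs′ ys′ : List A} → length xs ≡ length xs′ →
                      xs ++ ys ≡ xs′ ++ ys′ → xs ≡ xs′ × ys ≡ ys′
  ++-cancel-≡length {[]}     {xs′ = []}      _ e = refl , e
  ++-cancel-≡length {x ∷ xs} {xs′ = x′ ∷ xs′} l e =
    Product.map₁ (cong₂ _∷_ (∷-injectiveˡ e)) (++-cancel-≡length (suc-injective l) (∷-injectiveʳ e))

SameCircular-++ : ∀ xs y ys → SameCircular (xs ++ y ∷ ys) ((y ∷ ys) ++ xs)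
SameCircular-++ xs y ys =
  length xs ,
  subst (length xs <_) (sym (length-++ xs)) (m<m+n (length xs) z<s) ,
  cong₂ _++_ (drop-length-++ xs (y ∷ ys)) (take-length-++ xs (y ∷ ys))

SameCircular⇒rotation : ∀ {π τ} → SameCircular π τ → ∃[ P ] ∃[ D ] (π ≡ P ++ D × τ ≡ D ++ P)
SameCircular⇒rotation {π} (k , _ , refl) = take k π , drop k π , sym (take++drop≡id k π) , refl

ascending : ℕ → ℕ → List ℕ
ascending lo zero    = []
ascending lo (suc n) = lo ∷ ascending (suc lo) n

length-ascending : ∀ lo n → length (ascending lo n) ≡ n
length-ascending lo zero    = refl
length-ascending lo (suc n) = cong suc (length-ascending (suc lo) n)

ascending-lower : ∀ lo n → All (lo ≤_) (ascending lo n)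
ascending-lower lo zero    = []
ascending-lower lo (suc n) = ≤-refl ∷ All.map (≤-trans (n≤1+n lo)) (ascending-lower (suc lo) n)

ascending-upper : ∀ lo n → All (_< lo + n) (ascending lo n)
ascending-upper lo zero    = []
ascending-upper lo (suc n) =
  m<m+n lo z<s ∷ All.map (λ {y} → subst (y <_) (sym (+-suc lo n))) (ascending-upper (suc lo) n)

ascending-∷ʳ : ∀ lo n → ascending lo (suc n) ≡ ascending lo n ∷ʳ (lo + n)
ascending-∷ʳ lo zero    = cong (_∷ []) (sym (+-identityʳ lo))
ascending-∷ʳ lo (suc n) =
  cong (lo ∷_) (trans (ascending-∷ʳ (suc lo) n) (cong (ascending (suc lo) n ∷ʳ_) (sym (+-suc lo n))))

applyUpTo-ascending : ∀ (f : ℕ → ℕ) lo n → (∀ i → f i ≡ lo + i) → applyUpTo f n ≡ ascending lo n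
applyUpTo-ascending f lo zero    f≗ = refl
applyUpTo-ascending f lo (suc n) f≗ =
  cong₂ _∷_ (trans (f≗ 0) (+-identityʳ lo))
            (applyUpTo-ascending (λ i → f (suc i)) (suc lo) n (λ i → trans (f≗ (suc i)) (+-suc lo i)))

[1‥]≡ascending : ∀ n → [1‥ n ] ≡ ascending 1 n
[1‥]≡ascending n = trans (map-applyUpTo (λ i → i) suc n) (applyUpTo-ascending suc 1 n (λ _ → refl))

lastOr-∷ʳ : ∀ xs x → lastOr (xs ∷ʳ x) ≡ x
lastOr-∷ʳ []           x = refl
lastOr-∷ʳ (_ ∷ [])     x = refl
lastOr-∷ʳ (_ ∷ y ∷ ys) x = lastOr-∷ʳ (y ∷ ys) x

lastOr-ascending : ∀ lo n → lastOr (ascending lo (suc n)) ≡ lo + n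
lastOr-ascending lo n = trans (cong lastOr (ascending-∷ʳ lo n)) (lastOr-∷ʳ (ascending lo n) (lo + n))

remove-∉ : ∀ x xs → All (λ y → y ≢ x) xs → remove x xs ≡ xs
remove-∉ x xs = filter-all (λ y → ¬? (y ≟ x))

remove-head : ∀ x xs → All (λ y → y ≢ x) xs → remove x (x ∷ xs) ≡ xs
remove-head x xs x∉ = trans (filter-reject (λ y → ¬? (y ≟ x)) (λ x≢x → x≢x refl)) (remove-∉ x xs x∉)

remove-min-ascending : ∀ lo n → remove lo (ascending lo (suc n)) ≡ ascending (suc lo) n
remove-min-ascending lo n = remove-head lo _ (All.map >⇒≢ (ascending-lower (suc lo) n))

remove-max-ascending : ∀ lo n → remove (lo + n) (ascending lo (suc n)) ≡ ascending lo n
remove-max-ascending lo n = begin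
  remove (lo + n) (ascending lo (suc n))
    ≡⟨ cong (remove (lo + n)) (ascending-∷ʳ lo n) ⟩
  remove (lo + n) (ascending lo n ++ lo + n ∷ [])
    ≡⟨ filter-++ (λ y → ¬? (y ≟ lo + n)) (ascending lo n) _ ⟩
  remove (lo + n) (ascending lo n) ++ remove (lo + n) (lo + n ∷ [])
    ≡⟨ cong₂ _++_ (remove-∉ (lo + n) _ (All.map <⇒≢ (ascending-upper lo n))) (remove-head (lo + n) [] []) ⟩
  ascending lo n ++ []
    ≡⟨ ++-identityʳ _ ⟩
  ascending lo n
    ∎
  where open ≡-Reasoning

-- σ-from w lo is σ(w) on the values lo, …, lo + length w instead of 1, …, 1 + length w.
σ-from : Word → ℕ → List ℕ
σ-from []          lo = lo ∷ []
σ-from (false ∷ w) lo = lo ∷ σ-from w (suc lo)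
σ-from (true ∷ w)  lo = lo + suc (length w) ∷ σ-from w lo

σ-aux-ascending : ∀ w lo → σ-aux w (ascending lo (suc (length w))) ≡ σ-from w lo
σ-aux-ascending []          lo = refl
σ-aux-ascending (false ∷ w) lo =
  cong (lo ∷_) (trans (cong (σ-aux w) (remove-min-ascending lo _)) (σ-aux-ascending w (suc lo)))
σ-aux-ascending (true ∷ w)  lo rewrite lastOr-ascending lo (suc (length w)) =
  cong (lo + suc (length w) ∷_) (trans (cong (σ-aux w) (remove-max-ascending lo _)) (σ-aux-ascending w lo))

σ≡σ-from : ∀ w → σ w ≡ σ-from w 1
σ≡σ-from w = trans (cong (σ-aux w) ([1‥]≡ascending (suc (length w)))) (σ-aux-ascending w 1)

length-σ-from : ∀ w lo → length (σ-from w lo) ≡ suc (length w)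
length-σ-from []          lo = refl
length-σ-from (false ∷ w) lo = cong suc (length-σ-from w (suc lo))
length-σ-from (true ∷ w)  lo = cong suc (length-σ-from w lo)

σ-from-lower : ∀ w lo → All (lo ≤_) (σ-from w lo)
σ-from-lower []          lo = ≤-refl ∷ []
σ-from-lower (false ∷ w) lo = ≤-refl ∷ All.map (≤-trans (n≤1+n lo)) (σ-from-lower w (suc lo))
σ-from-lower (true ∷ w)  lo = m≤m+n lo _ ∷ σ-from-lower w lo

σ-from-upper : ∀ w lo → All (_≤ lo + length w) (σ-from w lo)
σ-from-upper []          lo = m≤m+n lo 0 ∷ []
σ-from-upper (false ∷ w) lo =
  m≤m+n lo _ ∷ All.map (λ x≤ → ≤-trans x≤ (≤-reflexive (sym (+-suc lo _)))) (σ-from-upper w (suc lo))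
σ-from-upper (true ∷ w)  lo =
  ≤-refl ∷ All.map (λ x≤ → ≤-trans x≤ (+-monoʳ-≤ lo (n≤1+n _))) (σ-from-upper w lo)

σ-from-injective : ∀ {w w′} lo → σ-from w lo ≡ σ-from w′ lo → w ≡ w′
σ-from-injective {[]}        {[]}         lo e = refl
σ-from-injective {[]}        {b ∷ w′}     lo e with () ← trans (cong length e) (length-σ-from (b ∷ w′) lo)
σ-from-injective {b ∷ w}     {[]}         lo e with () ← trans (cong length (sym e)) (length-σ-from (b ∷ w) lo)
σ-from-injective {false ∷ w} {false ∷ w′} lo e = cong (false ∷_) (σ-from-injective (suc lo) (∷-injectiveʳ e))
σ-from-injective {true ∷ w}  {true ∷ w′}  lo e = cong (true ∷_) (σ-from-injective lo (∷-injectiveʳ e))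
σ-from-injective {false ∷ w} {true ∷ w′}  lo e = ⊥-elim (m+1+n≢m lo (sym (∷-injectiveˡ e)))
σ-from-injective {true ∷ w}  {false ∷ w′} lo e = ⊥-elim (m+1+n≢m lo (∷-injectiveˡ e))

σ-from-zeros-++ : ∀ m u lo → σ-from (replicate m false ++ u) lo ≡ ascending lo m ++ σ-from u (lo + m)
σ-from-zeros-++ zero    u lo = cong (σ-from u) (sym (+-identityʳ lo))
σ-from-zeros-++ (suc m) u lo = cong (lo ∷_) (trans (σ-from-zeros-++ m u (suc lo))
  (cong (λ t → ascending (suc lo) m ++ σ-from u t) (sym (+-suc lo m))))

σ-from-ones-++ : ∀ m u lo →
                 σ-from (replicate m true ++ u) lo ≡ applyDownFrom (lo + suc (length u) +_) m ++ σ-from u lo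
σ-from-ones-++ zero    u lo = refl
σ-from-ones-++ (suc m) u lo = cong₂ _∷_ top (σ-from-ones-++ m u lo)
  where
  open ≡-Reasoning
  top : lo + suc (length (replicate m true ++ u)) ≡ lo + suc (length u) + m
  top = begin
    lo + suc (length (replicate m true ++ u))
      ≡⟨ cong (λ t → lo + suc t) (trans (length-++ (replicate m true)) (cong (_+ length u) (length-replicate m))) ⟩
    lo + suc (m + length u)
      ≡⟨ cong (λ t → lo + suc t) (+-comm m (length u)) ⟩
    lo + (suc (length u) + m)
      ≡⟨ +-assoc lo (suc (length u)) m ⟨
    lo + suc (length u) + m
      ∎

σ-from-zeros : ∀ m lo → σ-from (replicate m false) lo ≡ ascending lo (suc m)
σ-from-zeros zero    lo = refl
σ-from-zeros (suc m) lo = cong (lo ∷_) (σ-from-zeros m (suc lo))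

σ-from-ones : ∀ m lo → σ-from (replicate m true) lo ≡ applyDownFrom (lo +_) (suc m)
σ-from-ones zero    lo = cong (_∷ []) (sym (+-identityʳ lo))
σ-from-ones (suc m) lo = cong₂ _∷_ (cong (λ t → lo + suc t) (length-replicate m)) (σ-from-ones m lo)

σ-from-min∈take : ∀ p w lo → false ∈ take p w → lo ∈ take p (σ-from w lo)
σ-from-min∈take (suc p) (false ∷ w) lo _         = here refl
σ-from-min∈take (suc p) (true ∷ w)  lo (there f) = there (σ-from-min∈take p w lo f)

σ-from-min∉drop : ∀ p w lo → false ∈ take p w → ¬ lo ∈ drop p (σ-from w lo)
σ-from-min∉drop (suc p) (false ∷ w) lo _         lo∈ =
  <-irrefl refl (All.lookup (drop⁺ p (σ-from-lower w (suc lo))) lo∈)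
σ-from-min∉drop (suc p) (true ∷ w)  lo (there f) lo∈ = σ-from-min∉drop p w lo f lo∈

σ-from-max∈take : ∀ p w lo → true ∈ take p w → lo + length w ∈ take p (σ-from w lo)
σ-from-max∈take (suc p) (true ∷ w)  lo _         = here refl
σ-from-max∈take (suc p) (false ∷ w) lo (there t) =
  there (subst (_∈ take p (σ-from w (suc lo))) (sym (+-suc lo (length w))) (σ-from-max∈take p w (suc lo) t))

replicate-prefix⊎∈take : ∀ (c : Bool) p (w : Word) → p ≤ length w →
                         (∃[ v ] w ≡ replicate p c ++ v) ⊎ not c ∈ take p w
replicate-prefix⊎∈take c zero    w       _        = inj₁ (w , refl)
replicate-prefix⊎∈take c (suc p) (b ∷ w) (s≤s p≤) with b ≟ᵇ c
... | no  b≢c  = inj₂ (here (sym (¬-not b≢c)))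
... | yes refl = Sum.map (Product.map₂ (cong (c ∷_))) there (replicate-prefix⊎∈take c p w p≤)

σ-from-zeros-prefix : ∀ m w lo → m ≤ length w → All (_< lo + length w) (take m (σ-from w lo)) →
                      ∃[ u ] w ≡ replicate m false ++ u
σ-from-zeros-prefix m w lo m≤ below with replicate-prefix⊎∈take false m w m≤
... | inj₁ prefix = prefix
... | inj₂ t      = ⊥-elim (<-irrefl refl (All.lookup below (σ-from-max∈take m w lo t)))

σ-from-prefix-length : ∀ w lo P y D → σ-from w lo ≡ P ++ y ∷ D → length P ≤ length w
σ-from-prefix-length w lo P y D e = ≤-trans (m≤m+n (length P) (length D)) (≤-reflexive (suc-injective (begin
  suc (length P + length D) ≡⟨ +-suc (length P) (length D) ⟨
  length P + length (y ∷ D) ≡⟨ length-++ P ⟨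
  length (P ++ y ∷ D)       ≡⟨ cong length e ⟨
  length (σ-from w lo)      ≡⟨ length-σ-from w lo ⟩
  suc (length w)            ∎)))
  where open ≡-Reasoning

rotation-of-ones-prefix : ∀ lo b v w (P D : List ℕ) → length P ≡ suc b →
                          σ-from (replicate (suc b) true ++ v) lo ≡ P ++ D → σ-from w lo ≡ D ++ P →
                          w ≡ replicate (suc (length v)) false ++ replicate b true
                          × v ≡ replicate (length v) false
rotation-of-ones-prefix lo b v w P D |P| eπ eτ = trans w≡ (cong (replicate m false ++_) u≡) , v≡
  where
  open ≡-Reasoning
  m = suc (length v)

  high-low : applyDownFrom (lo + m +_) (suc b) ≡ P × σ-from v lo ≡ D
  high-low = ++-cancel-≡length (trans (length-applyDownFrom _ (suc b)) (sym |P|))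
                               (trans (sym (σ-from-ones-++ (suc b) v lo)) eπ)

  |D| : length D ≡ m
  |D| = trans (cong length (sym (proj₂ high-low))) (length-σ-from v lo)

  |w| : length w ≡ length v + suc b
  |w| = suc-injective (begin
    suc (length w)       ≡⟨ length-σ-from w lo ⟨
    length (σ-from w lo) ≡⟨ cong length eτ ⟩
    length (D ++ P)      ≡⟨ length-++ D ⟩
    length D + length P  ≡⟨ cong₂ _+_ |D| |P| ⟩
    m + suc b            ∎)

  max-of-D<max : lo + length v < lo + length w
  max-of-D<max = subst (λ n → lo + length v < lo + n) (sym |w|) (+-monoʳ-< lo (m<m+n (length v) z<s))

  D-below : All (_< lo + length w) D
  D-below = subst (All (_< lo + length w)) (proj₂ high-low)
                  (All.map (λ x≤ → ≤-<-trans x≤ max-of-D<max) (σ-from-upper v lo))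

  take-m≡D : take m (σ-from w lo) ≡ D
  take-m≡D = trans (cong (take m) eτ) (subst (λ k → take k (D ++ P) ≡ D) |D| (take-length-++ D P))

  m≤|w| : m ≤ length w
  m≤|w| = subst (m ≤_) (sym (trans |w| (+-suc (length v) b))) (s≤s (m≤m+n (length v) b))

  zeros-prefix : ∃[ u ] w ≡ replicate m false ++ u
  zeros-prefix = σ-from-zeros-prefix m w lo m≤|w| (subst (All (_< lo + length w)) (sym take-m≡D) D-below)

  u = proj₁ zeros-prefix
  w≡ = proj₂ zeros-prefix

  low-high : ascending lo m ≡ D × σ-from u (lo + m) ≡ P
  low-high = ++-cancel-≡length (trans (length-ascending lo m) (sym |D|))
    (trans (sym (σ-from-zeros-++ m u lo)) (trans (cong (λ x → σ-from x lo) (sym w≡)) eτ))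

  v≡ : v ≡ replicate (length v) false
  v≡ = σ-from-injective lo
    (trans (proj₂ high-low) (trans (sym (proj₁ low-high)) (sym (σ-from-zeros (length v) lo))))

  u≡ : u ≡ replicate b true
  u≡ = σ-from-injective (lo + m)
    (trans (proj₂ low-high) (trans (sym (proj₁ high-low)) (sym (σ-from-ones b (lo + m)))))

BlockSwap : Word → Word → Set
BlockSwap w₁ w₂ = ∃[ a ] ∃[ b ]
  ((w₁ ≡ replicate (suc a) false ++ replicate b true × w₂ ≡ replicate (suc b) true ++ replicate a false)
  ⊎ (w₁ ≡ replicate (suc b) true ++ replicate a false × w₂ ≡ replicate (suc a) false ++ replicate b true))

rotation⇒≡⊎BlockSwap : ∀ lo w₁ w₂ (P D : List ℕ) → σ-from w₁ lo ≡ P ++ D → σ-from w₂ lo ≡ D ++ P →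
                       w₁ ≡ w₂ ⊎ BlockSwap w₁ w₂
rotation⇒≡⊎BlockSwap lo w₁ w₂ [] D eπ eτ =
  inj₁ (σ-from-injective lo (trans eπ (sym (trans eτ (++-identityʳ D)))))
rotation⇒≡⊎BlockSwap lo w₁ w₂ P [] eπ eτ =
  inj₁ (σ-from-injective lo (trans (trans eπ (++-identityʳ P)) (sym eτ)))
rotation⇒≡⊎BlockSwap lo w₁ w₂ P@(x ∷ P′) D@(y ∷ D′) eπ eτ
  with replicate-prefix⊎∈take true (length P) w₁ (σ-from-prefix-length w₁ lo P y D′ eπ)
... | inj₁ (v , refl) =
  let (w₂≡ , v≡) = rotation-of-ones-prefix lo (length P′) v w₂ P D refl eπ eτ
  in inj₂ (length v , length P′ , inj₂ (cong (replicate (length P) true ++_) v≡ , w₂≡))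
... | inj₂ 0∈w₁ with replicate-prefix⊎∈take true (length D) w₂ (σ-from-prefix-length w₂ lo D x P′ eτ)
...   | inj₁ (v , refl) =
  let (w₁≡ , v≡) = rotation-of-ones-prefix lo (length D′) v w₁ D P refl eτ eπ
  in inj₂ (length v , length D′ , inj₁ (w₁≡ , cong (replicate (length D) true ++_) v≡))
...   | inj₂ 0∈w₂ =
  ⊥-elim (σ-from-min∉drop (length D) w₂ lo 0∈w₂ (subst (lo ∈_) P≡ (σ-from-min∈take (length P) w₁ lo 0∈w₁)))
  where
  P≡ : take (length P) (σ-from w₁ lo) ≡ drop (length D) (σ-from w₂ lo)
  P≡ = trans (trans (cong (take (length P)) eπ) (take-length-++ P D))
             (sym (trans (cong (drop (length D)) eτ) (drop-length-++ D P)))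

σ-from-up-down : ∀ a b lo → σ-from (replicate (suc a) false ++ replicate b true) lo
                            ≡ ascending lo (suc a) ++ applyDownFrom (lo + suc a +_) (suc b)
σ-from-up-down a b lo = trans (σ-from-zeros-++ (suc a) (replicate b true) lo)
                              (cong (ascending lo (suc a) ++_) (σ-from-ones b (lo + suc a)))

σ-from-down-up : ∀ a b lo → σ-from (replicate (suc b) true ++ replicate a false) lo
                            ≡ applyDownFrom (lo + suc a +_) (suc b) ++ ascending lo (suc a)
σ-from-down-up a b lo = trans (σ-from-ones-++ (suc b) (replicate a false) lo)
  (cong₂ (λ n xs → applyDownFrom (lo + suc n +_) (suc b) ++ xs) (length-replicate a) (σ-from-zeros a lo))

≡⊎BlockSwap⇒SameCircular : ∀ lo w₁ w₂ → w₁ ≡ w₂ ⊎ BlockSwap w₁ w₂ →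
                           SameCircular (σ-from w₁ lo) (σ-from w₂ lo)
≡⊎BlockSwap⇒SameCircular lo w w (inj₁ refl) =
  0 , subst (0 <_) (sym (length-σ-from w lo)) z<s , ++-identityʳ (σ-from w lo)
≡⊎BlockSwap⇒SameCircular lo w₁ w₂ (inj₂ (a , b , inj₁ (refl , refl))) =
  subst₂ SameCircular (sym (σ-from-up-down a b lo)) (sym (σ-from-down-up a b lo))
         (SameCircular-++ (ascending lo (suc a)) _ _)
≡⊎BlockSwap⇒SameCircular lo w₁ w₂ (inj₂ (a , b , inj₂ (refl , refl))) =
  subst₂ SameCircular (sym (σ-from-down-up a b lo)) (sym (σ-from-up-down a b lo))
         (SameCircular-++ (applyDownFrom (lo + suc a +_) (suc b)) _ _)

theorem3p6 : (w₁ w₂ : Word) →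
    SameCircular (σ w₁) (σ w₂)
      ⇔ (w₁ ≡ w₂
         ⊎ ∃[ a ] ∃[ b ]
             ((w₁ ≡ replicate (suc a) false ++ replicate b true
               × w₂ ≡ replicate (suc b) true ++ replicate a false)
             ⊎ (w₁ ≡ replicate (suc b) true ++ replicate a false
               × w₂ ≡ replicate (suc a) false ++ replicate b true)))
theorem3p6 w₁ w₂ rewrite σ≡σ-from w₁ | σ≡σ-from w₂ = mk⇔ classify (≡⊎BlockSwap⇒SameCircular 1 w₁ w₂)
  where
  classify : SameCircular (σ-from w₁ 1) (σ-from w₂ 1) → w₁ ≡ w₂ ⊎ BlockSwap w₁ w₂
  classify rot with P , D , eπ , eτ ← SameCircular⇒rotation rot = rotation⇒≡⊎BlockSwap 1 w₁ w₂ P D eπ eτ
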